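{- Let $\mathcal{K}$ be the set of all positions of misère partizan Kayles and let $n\ge 3$. Then, modulo $\mathcal{K}$, $$S_n\equiv\begin{cases} kS_1+kS_2, & \text{if } n=3k,\\ (k+1)S_1+kS_2, & \text{if } n=3k+1,\\ kS_1+(k+1)S_2, & \text{if } n=3k+2.\end{cases}$$
   Context: Partizan Kayles is played on $1\times n$ strips of squares; $S_n$ denotes an empty strip of length $n$, and $mG$ denotes the disjunctive sum of $m$ copies of $G$. Left moves by placing a single square on one empty cell; Right moves by placing a domino covering two adjacent empty cells of the same strip; a placement splits a strip into the strips of empty cells on either side. $\mathcal{K}$ is the set of all disjunctive sums of strips. Under misère play a player unable to move on their turn wins; $o^-(G)$ is the misère outcome. $G\equiv H\pmod{\mathcal{K}}$ means $o^-(G+X)=o^-(H+X)$ for all $X\in\mathcal{K}$. -}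

module Defs where

open import Data.Nat using (ℕ; zero; suc; _+_; _∸_)
open import Data.Bool using (Bool; true; false; not; if_then_else_)
open import Data.List using (List; []; _∷_; _++_; map; upTo; null)
open import Data.Bool.ListAction using (any)
open import Data.Nat.ListAction using (sum)
open import Data.Product using (_×_; _,_)
open import Relation.Binary.PropositionalEquality using (_≡_)

-- A position of partizan Kayles (an element of 𝒦) is a disjunctive sum of
-- strips, represented as the list of the lengths of its strips.
Pos : Set
Pos = List ℕ

S : ℕ → Pos
S n = n ∷ []

_⊕_ : Pos → Pos → Pos
G ⊕ H = G ++ H

infixl 6 _⊕_

_·_ : ℕ → Pos → Pos
zero  · G = []
suc m · G = G ⊕ (m · G)

infixr 7 _·_

-- Left places a square on cell i (0 ≤ i < n) of a strip of length n,
-- leaving strips of lengths i and n-1-i.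
leftSplits : ℕ → List (ℕ × ℕ)
leftSplits zero    = []
leftSplits (suc m) = map (λ i → i , m ∸ i) (upTo (suc m))

-- Right places a domino on cells i, i+1 (0 ≤ i ≤ n-2) of a strip of length n,
-- leaving strips of lengths i and n-2-i.
rightSplits : ℕ → List (ℕ × ℕ)
rightSplits zero          = []
rightSplits (suc zero)    = []
rightSplits (suc (suc m)) = map (λ i → i , m ∸ i) (upTo (suc m))

options : (ℕ → List (ℕ × ℕ)) → Pos → List Pos
options sp []      = []
options sp (x ∷ G) =
  map (λ { (a , b) → a ∷ b ∷ G }) (sp x) ++ map (x ∷_) (options sp G)

leftOptions rightOptions : Pos → List Pos
leftOptions  = options leftSplits
rightOptions = options rightSplits

-- Misère play, computed with fuel.  lwinsF f G: Left, moving first in G,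
-- wins (a player with no move on their turn wins).  Every move decreases
-- the total number of empty cells by at least one, so fuel (sum G + 1)
-- suffices to evaluate the whole game tree.
lwinsF rwinsF : ℕ → Pos → Bool
lwinsF zero    G = false
lwinsF (suc f) G =
  if null (leftOptions G) then true
  else any (λ G' → not (rwinsF f G')) (leftOptions G)
rwinsF zero    G = false
rwinsF (suc f) G =
  if null (rightOptions G) then true
  else any (λ G' → not (lwinsF f G')) (rightOptions G)

lwins rwins : Pos → Bool
lwins G = lwinsF (suc (sum G)) G
rwins G = rwinsF (suc (sum G)) G

data Outcome : Set where
  𝓛 𝓝 𝓟 𝓡 : Outcome

outcomeOf : Bool → Bool → Outcome
outcomeOf true  true  = 𝓝
outcomeOf true  false = 𝓛
outcomeOf false true  = 𝓡
outcomeOf false false = 𝓟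

o⁻ : Pos → Outcome
o⁻ G = outcomeOf (lwins G) (rwins G)

_≡𝒦_ : Pos → Pos → Set
G ≡𝒦 H = ∀ (X : Pos) → o⁻ (G ⊕ X) ≡ o⁻ (H ⊕ X)

infix 4 _≡𝒦_

-- Give the strip S_n the value 0, -1 or +1 according as n ≡ 0, 1 or 2 (mod 3), and a
-- position the sum of the values of its strips.  A Left move changes the value by +1 or
-- -2 and a Right move by -1 or +2.  Left can always choose +1 unless every strip has
-- length 0 or 2, in which case -2 is available; Right can always choose -1.  By
-- induction on the game tree, Left moving first wins exactly when the value v lies in
-- 3ℕ = {0, 3, 6, …}, and Right moving first wins exactly when v - 1 does not.  Hence the
-- misère outcome of G + X depends only on value G + value X, and S_n is equivalent to
-- any sum of copies of S_1 and S_2 of the same value.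
module Submission where

open import Defs
open import Data.Bool using (Bool; true; false; not; if_then_else_)
open import Data.Bool.ListAction using (any; or)
open import Data.Bool.Properties using (T-≡)
open import Data.Integer as ℤ using (ℤ; +_; -[1+_])
import Data.Integer.Properties as ℤₚ
open import Data.Integer.Tactic.RingSolver using (solve-∀)
open import Data.List using (List; []; _∷_; _++_; map; upTo; null)
open import Data.List.Properties using (map-cong-local)
open import Data.List.Membership.Propositional using (_∈_; find; lose)
open import Data.List.Membership.Propositional.Properties
  using (∈-map⁺; ∈-map⁻; ∈-++⁺ˡ; ∈-++⁺ʳ; ∈-++⁻; ∈-upTo⁺; ∈-upTo⁻; ∈-∃++)
open import Data.List.Relation.Unary.All as All using (All; []; _∷_)
open import Data.List.Relation.Unary.All.Properties using (++⁻)
open import Data.List.Relation.Unary.Any using (Any; here; there)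
open import Data.List.Relation.Unary.Any.Properties using (any⁺)
open import Data.Nat using (ℕ; zero; suc; _+_; _*_; _∸_; _≤_; _<_; z≤n; s≤s)
import Data.Nat.Properties as ℕₚ
open import Data.Nat.ListAction using (sum)
open import Data.Nat.ListAction.Properties using (sum-++)
open import Data.Product using (_×_; _,_; proj₁; proj₂; uncurry; ∃-syntax)
open import Data.Sum as Sum using (_⊎_; inj₁; inj₂)
open import Data.Empty using (⊥-elim)
open import Function using (_∘_; case_of_; Equivalence)
open import Relation.Binary.PropositionalEquality

module _ {A : Set} where

  all-or-any : {P Q : A → Set} → (∀ x → P x ⊎ Q x) → ∀ xs → All P xs ⊎ Any Q xs
  all-or-any pq []       = inj₁ []
  all-or-any pq (x ∷ xs) with pq x | all-or-any pq xs
  ... | inj₂ qx | _        = inj₂ (here qx)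
  ... | inj₁ px | inj₁ pxs = inj₁ (px ∷ pxs)
  ... | inj₁ _  | inj₂ qxs = inj₂ (there qxs)

  Any-split : {P : A → Set} {xs : List A} → Any P xs →
              ∃[ ys ] ∃[ x ] ∃[ zs ] xs ≡ ys ++ x ∷ zs × P x
  Any-split p with find p
  ... | x , x∈xs , px with ∈-∃++ x∈xs
  ...   | ys , zs , xs≡ = ys , x , zs , xs≡ , px

  map-≡[] : {B : Set} {f : A → B} (xs : List A) → map f xs ≡ [] → xs ≡ []
  map-≡[] [] _ = refl

  module _ (p : A → Bool) where

    any-cong : ∀ {q : A → Bool} xs → (∀ {x} → x ∈ xs → p x ≡ q x) → any p xs ≡ any q xs
    any-cong xs p≡q = cong or (map-cong-local (All.tabulate p≡q))

    any-true : ∀ {x xs} → x ∈ xs → p x ≡ true → any p xs ≡ true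
    any-true x∈xs px =
      Equivalence.to T-≡ (any⁺ p (lose x∈xs (Equivalence.from T-≡ px)))

    any-false : ∀ xs → (∀ {x} → x ∈ xs → p x ≡ false) → any p xs ≡ false
    any-false []       _      = refl
    any-false (x ∷ xs) p≡false rewrite p≡false (here refl) = any-false xs (p≡false ∘ there)

    if-null-any : ∀ xs {b} → (xs ≡ [] → b ≡ true) → (∀ {x} → x ∈ xs → any p xs ≡ b) →
                  (if null xs then true else any p xs) ≡ b
    if-null-any []       nil _    = sym (nil refl)
    if-null-any (_ ∷ _)  _   cons = cons (here refl)

data Move (sp : ℕ → List (ℕ × ℕ)) (G G' : Pos) : Set where
  move : ∀ H x K {a b} → (a , b) ∈ sp x → G ≡ H ++ x ∷ K → G' ≡ H ++ a ∷ b ∷ K → Move sp G G'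

options⁻ : ∀ sp G {G'} → G' ∈ options sp G → Move sp G G'
options⁻ sp (x ∷ G) G'∈ with ∈-++⁻ (map (λ { (a , b) → a ∷ b ∷ G }) (sp x)) G'∈
... | inj₁ here∈ with ∈-map⁻ (λ { (a , b) → a ∷ b ∷ G }) here∈
...   | _ , ab∈ , refl = move [] x G ab∈ refl refl
options⁻ sp (x ∷ G) G'∈ | inj₂ later∈ with ∈-map⁻ (x ∷_) later∈
...   | _ , G''∈ , refl with options⁻ sp G G''∈
...     | move H y K ab∈ refl refl = move (x ∷ H) y K ab∈ refl refl

options⁺ : ∀ {sp} H K {x a b} → (a , b) ∈ sp x → H ++ a ∷ b ∷ K ∈ options sp (H ++ x ∷ K)
options⁺ []      K ab∈ = ∈-++⁺ˡ (∈-map⁺ (λ { (a , b) → a ∷ b ∷ K }) ab∈)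
options⁺ {sp} (y ∷ H) K {x} ab∈ =
  ∈-++⁺ʳ (map (λ { (a , b) → a ∷ b ∷ H ++ x ∷ K }) (sp y)) (∈-map⁺ (y ∷_) (options⁺ H K ab∈))

-- leftSplits (suc m) and rightSplits (suc (suc m)) both unfold to splits m.
splits : ℕ → List (ℕ × ℕ)
splits m = map (λ i → i , m ∸ i) (upTo (suc m))

splits⁻ : ∀ {m a b} → (a , b) ∈ splits m → a + b ≡ m
splits⁻ {m} ab∈ with ∈-map⁻ (λ i → i , m ∸ i) ab∈
... | i , i∈ , refl = ℕₚ.m+[n∸m]≡n (ℕₚ.≤-pred (∈-upTo⁻ i∈))

splits⁺ : ∀ {m i} → i ≤ m → (i , m ∸ i) ∈ splits m
splits⁺ {m} i≤m = ∈-map⁺ (λ i → i , m ∸ i) (∈-upTo⁺ (s≤s i≤m))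

leftSplits⁻ : ∀ {x a b} → (a , b) ∈ leftSplits x → ∃[ m ] x ≡ suc m × a + b ≡ m
leftSplits⁻ {suc m} ab∈ = m , refl , splits⁻ ab∈

rightSplits⁻ : ∀ {x a b} → (a , b) ∈ rightSplits x → ∃[ m ] x ≡ suc (suc m) × a + b ≡ m
rightSplits⁻ {suc (suc m)} ab∈ = m , refl , splits⁻ ab∈

sum-replace : ∀ H K {x a b} → a + b < x → sum (H ++ a ∷ b ∷ K) < sum (H ++ x ∷ K)
sum-replace H K {x} {a} {b} a+b<x rewrite sum-++ H (a ∷ b ∷ K) | sum-++ H (x ∷ K) =
  ℕₚ.+-monoʳ-< (sum H)
    (subst (_< x + sum K) (ℕₚ.+-assoc a b (sum K)) (ℕₚ.+-monoˡ-< (sum K) a+b<x))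

options-sum : ∀ {sp} → (∀ {x a b} → (a , b) ∈ sp x → a + b < x) →
              ∀ G {G'} → G' ∈ options sp G → sum G' < sum G
options-sum {sp} shrinks G G'∈ with options⁻ sp G G'∈
... | move H x K ab∈ refl refl = sum-replace H K (shrinks ab∈)

leftSplits-< : ∀ {x a b} → (a , b) ∈ leftSplits x → a + b < x
leftSplits-< {suc m} ab∈ rewrite splits⁻ ab∈ = ℕₚ.≤-refl

rightSplits-< : ∀ {x a b} → (a , b) ∈ rightSplits x → a + b < x
rightSplits-< {suc (suc m)} ab∈ rewrite splits⁻ ab∈ = ℕₚ.n≤1+n (suc m)

stripValue : ℕ → ℤ
stripValue 0                   = + 0
stripValue 1                   = -[1+ 0 ]
stripValue 2                   = + 1
stripValue (suc (suc (suc n))) = stripValue n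

value : Pos → ℤ
value []      = + 0
value (n ∷ G) = stripValue n ℤ.+ value G

value-++ : ∀ G H → value (G ++ H) ≡ value G ℤ.+ value H
value-++ []      H = sym (ℤₚ.+-identityˡ (value H))
value-++ (n ∷ G) H = begin
  stripValue n ℤ.+ value (G ++ H)            ≡⟨ cong (ℤ._+_ (stripValue n)) (value-++ G H) ⟩
  stripValue n ℤ.+ (value G ℤ.+ value H)     ≡⟨ ℤₚ.+-assoc (stripValue n) (value G) (value H) ⟨
  stripValue n ℤ.+ value G ℤ.+ value H       ∎
  where open ≡-Reasoning

value-replace : ∀ H K {x a b δ} → stripValue a ℤ.+ stripValue b ≡ stripValue x ℤ.+ δ →
                value (H ++ a ∷ b ∷ K) ≡ value (H ++ x ∷ K) ℤ.+ δ
value-replace H K {x} {a} {b} {δ} split = begin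
  value (H ++ a ∷ b ∷ K)                                       ≡⟨ value-++ H _ ⟩
  value H ℤ.+ (stripValue a ℤ.+ (stripValue b ℤ.+ value K))    ≡⟨ regroup (value H) (stripValue a) (stripValue b) (value K) ⟩
  value H ℤ.+ ((stripValue a ℤ.+ stripValue b) ℤ.+ value K)    ≡⟨ cong (λ s → value H ℤ.+ (s ℤ.+ value K)) split ⟩
  value H ℤ.+ ((stripValue x ℤ.+ δ) ℤ.+ value K)               ≡⟨ regroup′ (value H) (stripValue x) δ (value K) ⟩
  value H ℤ.+ (stripValue x ℤ.+ value K) ℤ.+ δ                 ≡⟨ cong (λ v → v ℤ.+ δ) (value-++ H _) ⟨
  value (H ++ x ∷ K) ℤ.+ δ                                     ∎
  where
  open ≡-Reasoning
  regroup : ∀ h a b k → h ℤ.+ (a ℤ.+ (b ℤ.+ k)) ≡ h ℤ.+ ((a ℤ.+ b) ℤ.+ k)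
  regroup = solve-∀
  regroup′ : ∀ h x d k → h ℤ.+ ((x ℤ.+ d) ℤ.+ k) ≡ h ℤ.+ (x ℤ.+ k) ℤ.+ d
  regroup′ = solve-∀

-- Both sides agree mod 3 because stripValue n ≡ -n (mod 3); periodicity reduces the
-- check to i, j < 3.
leftSplit-value : ∀ i j →
  stripValue i ℤ.+ stripValue j ≡ stripValue (suc (i + j)) ℤ.+ + 1 ⊎
  stripValue i ℤ.+ stripValue j ≡ stripValue (suc (i + j)) ℤ.- + 2
leftSplit-value (suc (suc (suc i))) j = leftSplit-value i j
leftSplit-value 0 0                   = inj₁ refl
leftSplit-value 0 1                   = inj₂ refl
leftSplit-value 0 2                   = inj₁ refl
leftSplit-value 0 (suc (suc (suc j))) = leftSplit-value 0 j
leftSplit-value 1 0                   = inj₂ refl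
leftSplit-value 1 1                   = inj₂ refl
leftSplit-value 1 2                   = inj₁ refl
leftSplit-value 1 (suc (suc (suc j))) = leftSplit-value 1 j
leftSplit-value 2 0                   = inj₁ refl
leftSplit-value 2 1                   = inj₁ refl
leftSplit-value 2 2                   = inj₁ refl
leftSplit-value 2 (suc (suc (suc j))) = leftSplit-value 2 j

rightSplit-value : ∀ i j →
  stripValue i ℤ.+ stripValue j ≡ stripValue (suc (suc (i + j))) ℤ.- + 1 ⊎
  stripValue i ℤ.+ stripValue j ≡ stripValue (suc (suc (i + j))) ℤ.+ + 2
rightSplit-value (suc (suc (suc i))) j = rightSplit-value i j
rightSplit-value 0 0                   = inj₁ refl
rightSplit-value 0 1                   = inj₁ refl
rightSplit-value 0 2                   = inj₂ refl
rightSplit-value 0 (suc (suc (suc j))) = rightSplit-value 0 j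
rightSplit-value 1 0                   = inj₁ refl
rightSplit-value 1 1                   = inj₁ refl
rightSplit-value 1 2                   = inj₁ refl
rightSplit-value 1 (suc (suc (suc j))) = rightSplit-value 1 j
rightSplit-value 2 0                   = inj₂ refl
rightSplit-value 2 1                   = inj₁ refl
rightSplit-value 2 2                   = inj₂ refl
rightSplit-value 2 (suc (suc (suc j))) = rightSplit-value 2 j

leftOption-value : ∀ G {G'} → G' ∈ leftOptions G →
  value G' ≡ value G ℤ.+ + 1 ⊎ value G' ≡ value G ℤ.- + 2
leftOption-value G G'∈ with options⁻ leftSplits G G'∈
... | move H x K {a} {b} ab∈ refl refl with leftSplits⁻ {x} ab∈
...   | _ , refl , refl = Sum.map (value-replace H K) (value-replace H K) (leftSplit-value a b)

rightOption-value : ∀ G {G'} → G' ∈ rightOptions G →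
  value G' ≡ value G ℤ.- + 1 ⊎ value G' ≡ value G ℤ.+ + 2
rightOption-value G G'∈ with options⁻ rightSplits G G'∈
... | move H x K {a} {b} ab∈ refl refl with rightSplits⁻ {x} ab∈
...   | _ , refl , refl = Sum.map (value-replace H K) (value-replace H K) (rightSplit-value a b)

stripValue-3+∸ : ∀ {i m} → i ≤ m → stripValue (3 + m ∸ i) ≡ stripValue (m ∸ i)
stripValue-3+∸ i≤m = cong stripValue (ℕₚ.+-∸-assoc 3 i≤m)

leftSplit-+1 : ∀ m → m ≢ 1 →
  ∃[ i ] i ≤ m × stripValue i ℤ.+ stripValue (m ∸ i) ≡ stripValue (suc m) ℤ.+ + 1
leftSplit-+1 0 _   = 0 , z≤n , refl
leftSplit-+1 1 m≢1 = ⊥-elim (m≢1 refl)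
leftSplit-+1 2 _   = 0 , z≤n , refl
leftSplit-+1 3 _   = 0 , z≤n , refl
leftSplit-+1 4 _   = 2 , s≤s (s≤s z≤n) , refl
leftSplit-+1 (suc (suc (suc m@(suc (suc _))))) _ with leftSplit-+1 m (λ ())
... | i , i≤m , split =
  i , ℕₚ.m≤n⇒m≤o+n 3 i≤m , trans (cong (ℤ._+_ (stripValue i)) (stripValue-3+∸ i≤m)) split

rightSplit-−1 : ∀ m →
  ∃[ i ] i ≤ m × stripValue i ℤ.+ stripValue (m ∸ i) ≡ stripValue (suc (suc m)) ℤ.- + 1
rightSplit-−1 0 = 0 , z≤n , refl
rightSplit-−1 1 = 0 , z≤n , refl
rightSplit-−1 2 = 1 , s≤s z≤n , refl
rightSplit-−1 (suc (suc (suc m))) with rightSplit-−1 m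
... | i , i≤m , split =
  i , ℕₚ.m≤n⇒m≤o+n 3 i≤m , trans (cong (ℤ._+_ (stripValue i)) (stripValue-3+∸ i≤m)) split

leftOption-+1 : ∀ H m K → m ≢ 1 →
  ∃[ G' ] G' ∈ leftOptions (H ++ suc m ∷ K) × value G' ≡ value (H ++ suc m ∷ K) ℤ.+ + 1
leftOption-+1 H m K m≢1 with leftSplit-+1 m m≢1
... | i , i≤m , split = H ++ i ∷ m ∸ i ∷ K , options⁺ H K (splits⁺ i≤m) , value-replace H K split

leftOption-−2 : ∀ H K → H ++ 0 ∷ 1 ∷ K ∈ leftOptions (H ++ 2 ∷ K)
leftOption-−2 H K = options⁺ H K (splits⁺ z≤n)

rightOption-−1 : ∀ H m K →
  ∃[ G' ] G' ∈ rightOptions (H ++ suc (suc m) ∷ K) × value G' ≡ value (H ++ suc (suc m) ∷ K) ℤ.- + 1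
rightOption-−1 H m K with rightSplit-−1 m
... | i , i≤m , split = H ++ i ∷ m ∸ i ∷ K , options⁺ H K (splits⁺ i≤m) , value-replace H K split

leftOption-strip : ∀ G {G'} → G' ∈ leftOptions G → ∃[ H ] ∃[ m ] ∃[ K ] G ≡ H ++ suc m ∷ K
leftOption-strip G G'∈ with options⁻ leftSplits G G'∈
... | move H x K ab∈ refl _ with leftSplits⁻ {x} ab∈
...   | m , refl , _ = H , m , K , refl

rightOption-strip : ∀ G {G'} → G' ∈ rightOptions G → ∃[ H ] ∃[ m ] ∃[ K ] G ≡ H ++ suc (suc m) ∷ K
rightOption-strip G G'∈ with options⁻ rightSplits G G'∈
... | move H x K ab∈ refl _ with rightSplits⁻ {x} ab∈
...   | m , refl , _ = H , m , K , refl

value-noLeftOptions : ∀ G → leftOptions G ≡ [] → value G ≡ + 0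
value-noLeftOptions []                _    = refl
value-noLeftOptions (zero ∷ G)        none =
  trans (ℤₚ.+-identityˡ (value G)) (value-noLeftOptions G (map-≡[] _ none))
value-noLeftOptions (suc _ ∷ _)       ()

value-noRightOptions : ∀ G → rightOptions G ≡ [] → value G ℤ.≤ + 0
value-noRightOptions []                _    = ℤ.+≤+ z≤n
value-noRightOptions (0 ∷ G)           none =
  ℤₚ.+-mono-≤ (ℤ.+≤+ z≤n) (value-noRightOptions G (map-≡[] _ none))
value-noRightOptions (1 ∷ G)           none =
  ℤₚ.+-mono-≤ ℤ.-≤+ (value-noRightOptions G (map-≡[] _ none))
value-noRightOptions (suc (suc _) ∷ _) ()

ZeroOrTwo : ℕ → Set
ZeroOrTwo n = n ≡ 0 ⊎ n ≡ 2

zeroOrTwo-or-leftRaises : ∀ n → ZeroOrTwo n ⊎ ∃[ m ] n ≡ suc m × m ≢ 1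
zeroOrTwo-or-leftRaises 0                   = inj₁ (inj₁ refl)
zeroOrTwo-or-leftRaises 1                   = inj₂ (0 , refl , λ ())
zeroOrTwo-or-leftRaises 2                   = inj₁ (inj₂ refl)
zeroOrTwo-or-leftRaises (suc (suc (suc m))) = inj₂ (suc (suc m) , refl , λ ())

value-zeroOrTwo : ∀ {G} → All ZeroOrTwo G → ∃[ c ] value G ≡ + c
value-zeroOrTwo []                  = 0 , refl
value-zeroOrTwo (inj₁ refl ∷ all02) with value-zeroOrTwo all02
... | c , eq = c , cong (ℤ._+_ (+ 0)) eq
value-zeroOrTwo (inj₂ refl ∷ all02) with value-zeroOrTwo all02
... | c , eq = suc c , cong (ℤ._+_ (+ 1)) eq

value-zeroOrTwo-positive : ∀ H K → All ZeroOrTwo H → All ZeroOrTwo K →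
                           ∃[ n ] value (H ++ 2 ∷ K) ≡ + suc n
value-zeroOrTwo-positive H K all02-H all02-K
  with value-zeroOrTwo all02-H | value-zeroOrTwo all02-K
... | c , eqH | d , eqK = c + d , (begin
  value (H ++ 2 ∷ K)               ≡⟨ value-++ H (2 ∷ K) ⟩
  value H ℤ.+ (+ 1 ℤ.+ value K)    ≡⟨ cong₂ (λ u w → u ℤ.+ (+ 1 ℤ.+ w)) eqH eqK ⟩
  + (c + suc d)                    ≡⟨ cong +_ (ℕₚ.+-suc c d) ⟩
  + suc (c + d)                    ∎)
  where open ≡-Reasoning

multipleOf3 : ℕ → Bool
multipleOf3 0                   = true
multipleOf3 1                   = false
multipleOf3 2                   = false
multipleOf3 (suc (suc (suc n))) = multipleOf3 n

leftWinsAt : ℤ → Bool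
leftWinsAt (+ n)    = multipleOf3 n
leftWinsAt -[1+ _ ] = false

rightWinsAt : ℤ → Bool
rightWinsAt v = not (leftWinsAt (v ℤ.- + 1))

leftWinsAt-+3 : ∀ v → leftWinsAt v ≡ true → leftWinsAt (v ℤ.+ + 3) ≡ true
leftWinsAt-+3 (+ n) wins rewrite ℕₚ.+-comm n 3 = wins

leftWinsAt-−3 : ∀ v → leftWinsAt v ≡ false → leftWinsAt (v ℤ.- + 3) ≡ false
leftWinsAt-−3 v loses with leftWinsAt (v ℤ.- + 3) in wins
... | false = refl
... | true  = case trans (sym loses) winsAt-v of λ ()
  where
  cancel : ∀ v → v ℤ.- + 3 ℤ.+ + 3 ≡ v
  cancel = solve-∀
  winsAt-v : leftWinsAt v ≡ true
  winsAt-v = subst (λ u → leftWinsAt u ≡ true) (cancel v) (leftWinsAt-+3 (v ℤ.- + 3) wins)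

leftWinsAt-pos−3 : ∀ n → leftWinsAt (+ suc n) ≡ true → leftWinsAt (+ suc n ℤ.- + 3) ≡ true
leftWinsAt-pos−3 (suc (suc _)) wins = wins

rightWinsAt-≤0 : ∀ {v} → v ℤ.≤ + 0 → rightWinsAt v ≡ true
rightWinsAt-≤0 (ℤ.+≤+ z≤n) = refl
rightWinsAt-≤0 ℤ.-≤+       = refl

rightWinsAt-+1 : ∀ v → rightWinsAt (v ℤ.+ + 1) ≡ not (leftWinsAt v)
rightWinsAt-+1 v = cong (not ∘ leftWinsAt) (shift v)
  where
  shift : ∀ v → v ℤ.+ + 1 ℤ.- + 1 ≡ v
  shift = solve-∀

rightWinsAt-−2 : ∀ v → rightWinsAt (v ℤ.- + 2) ≡ not (leftWinsAt (v ℤ.- + 3))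
rightWinsAt-−2 v = cong (not ∘ leftWinsAt) (shift v)
  where
  shift : ∀ v → v ℤ.- + 2 ℤ.- + 1 ≡ v ℤ.- + 3
  shift = solve-∀

leftWinsAt-+2 : ∀ v → leftWinsAt (v ℤ.+ + 2) ≡ leftWinsAt (v ℤ.- + 1 ℤ.+ + 3)
leftWinsAt-+2 v = cong leftWinsAt (shift v)
  where
  shift : ∀ v → v ℤ.+ + 2 ≡ v ℤ.- + 1 ℤ.+ + 3
  shift = solve-∀

rightWins-afterLeftMove : ∀ G {G'} → leftWinsAt (value G) ≡ false → G' ∈ leftOptions G →
                          rightWinsAt (value G') ≡ true
rightWins-afterLeftMove G {G'} loses G'∈ with leftOption-value G G'∈
... | inj₁ up   rewrite up   = trans (rightWinsAt-+1 (value G)) (cong not loses)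
... | inj₂ down rewrite down =
  trans (rightWinsAt-−2 (value G)) (cong not (leftWinsAt-−3 (value G) loses))

any-leftOptions : ∀ G {G₀} → G₀ ∈ leftOptions G →
  any (λ G' → not (rightWinsAt (value G'))) (leftOptions G) ≡ leftWinsAt (value G)
any-leftOptions G G₀∈ with leftWinsAt (value G) in wins
... | false = any-false _ (leftOptions G) (cong not ∘ rightWins-afterLeftMove G wins)
... | true with all-or-any zeroOrTwo-or-leftRaises G
...   | inj₂ raising with Any-split raising
...     | H , _ , K , refl , m , refl , m≢1 with leftOption-+1 H m K m≢1
...       | G' , G'∈ , up = any-true _ G'∈ (begin
  not (rightWinsAt (value G'))                 ≡⟨ cong (not ∘ rightWinsAt) up ⟩
  not (rightWinsAt (value G ℤ.+ + 1))          ≡⟨ cong not (rightWinsAt-+1 (value G)) ⟩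
  not (not (leftWinsAt (value G)))             ≡⟨ cong (not ∘ not) wins ⟩
  true                                         ∎)
  where open ≡-Reasoning
any-leftOptions G G₀∈ | true | inj₁ all02 with leftOption-strip G G₀∈
... | H , m , K , refl with ++⁻ H all02
...   | all02-H , inj₂ refl ∷ all02-K with value-zeroOrTwo-positive H K all02-H all02-K
...     | n , positive = any-true _ (leftOption-−2 H K) (begin
  not (rightWinsAt (value (H ++ 0 ∷ 1 ∷ K)))   ≡⟨ cong (not ∘ rightWinsAt) (value-replace H K refl) ⟩
  not (rightWinsAt (value G ℤ.- + 2))          ≡⟨ cong (λ v → not (rightWinsAt (v ℤ.- + 2))) positive ⟩
  not (rightWinsAt (+ suc n ℤ.- + 2))          ≡⟨ cong not (rightWinsAt-−2 (+ suc n)) ⟩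
  not (not (leftWinsAt (+ suc n ℤ.- + 3)))     ≡⟨ cong (not ∘ not) (leftWinsAt-pos−3 n winsAt-n) ⟩
  true                                         ∎)
  where
  open ≡-Reasoning
  winsAt-n : leftWinsAt (+ suc n) ≡ true
  winsAt-n = subst (λ v → leftWinsAt v ≡ true) positive wins

any-rightOptions : ∀ G {G₀} → G₀ ∈ rightOptions G →
  any (λ G' → not (leftWinsAt (value G'))) (rightOptions G) ≡ not (leftWinsAt (value G ℤ.- + 1))
any-rightOptions G G₀∈ with leftWinsAt (value G ℤ.- + 1) in wins
... | true = any-false _ (rightOptions G) leftWins-afterRightMove
  where
  leftWins-afterRightMove : ∀ {G'} → G' ∈ rightOptions G → not (leftWinsAt (value G')) ≡ false
  leftWins-afterRightMove G'∈ with rightOption-value G G'∈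
  ... | inj₁ down rewrite down = cong not wins
  ... | inj₂ up   rewrite up   =
    cong not (trans (leftWinsAt-+2 (value G)) (leftWinsAt-+3 (value G ℤ.- + 1) wins))
... | false with rightOption-strip G G₀∈
...   | H , m , K , refl with rightOption-−1 H m K
...     | G' , G'∈ , down = any-true _ G'∈ (cong not (trans (cong leftWinsAt down) wins))

leftWins-byValue : ∀ {f} G → (∀ {G'} → G' ∈ leftOptions G → rwinsF f G' ≡ rightWinsAt (value G')) →
                   lwinsF (suc f) G ≡ leftWinsAt (value G)
leftWins-byValue G ih = if-null-any _ (leftOptions G)
  (λ none → cong leftWinsAt (value-noLeftOptions G none))
  (λ G₀∈ → trans (any-cong _ (leftOptions G) (cong not ∘ ih)) (any-leftOptions G G₀∈))

rightWins-byValue : ∀ {f} G → (∀ {G'} → G' ∈ rightOptions G → lwinsF f G' ≡ leftWinsAt (value G')) →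
                    rwinsF (suc f) G ≡ rightWinsAt (value G)
rightWins-byValue G ih = if-null-any _ (rightOptions G)
  (λ none → rightWinsAt-≤0 (value-noRightOptions G none))
  (λ G₀∈ → trans (any-cong _ (rightOptions G) (cong not ∘ ih)) (any-rightOptions G G₀∈))

wins-byValue : ∀ f G → sum G < f →
               lwinsF f G ≡ leftWinsAt (value G) × rwinsF f G ≡ rightWinsAt (value G)
wins-byValue (suc f) G (s≤s sum≤f) =
    leftWins-byValue {f} G (λ {G'} G'∈ → proj₂ (wins-byValue f G' (fuel (options-sum leftSplits-< G G'∈))))
  , rightWins-byValue {f} G (λ {G'} G'∈ → proj₁ (wins-byValue f G' (fuel (options-sum rightSplits-< G G'∈))))
  where
  fuel : ∀ {n} → n < sum G → n < f
  fuel n<sum = ℕₚ.<-≤-trans n<sum sum≤f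

outcomeAt : ℤ → Outcome
outcomeAt v = outcomeOf (leftWinsAt v) (rightWinsAt v)

o⁻-byValue : ∀ G → o⁻ G ≡ outcomeAt (value G)
o⁻-byValue G = uncurry (cong₂ outcomeOf) (wins-byValue (suc (sum G)) G ℕₚ.≤-refl)

≡𝒦-byValue : ∀ G H → value G ≡ value H → G ≡𝒦 H
≡𝒦-byValue G H same X = begin
  o⁻ (G ⊕ X)                        ≡⟨ o⁻-byValue (G ⊕ X) ⟩
  outcomeAt (value (G ++ X))        ≡⟨ cong outcomeAt (value-++ G X) ⟩
  outcomeAt (value G ℤ.+ value X)   ≡⟨ cong (λ v → outcomeAt (v ℤ.+ value X)) same ⟩
  outcomeAt (value H ℤ.+ value X)   ≡⟨ cong outcomeAt (value-++ H X) ⟨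
  outcomeAt (value (H ++ X))        ≡⟨ o⁻-byValue (H ⊕ X) ⟨
  o⁻ (H ⊕ X)                        ∎
  where open ≡-Reasoning

value-· : ∀ k G → value (k · G) ≡ + k ℤ.* value G
value-· zero    G = refl
value-· (suc k) G = begin
  value (G ++ k · G)                 ≡⟨ value-++ G (k · G) ⟩
  value G ℤ.+ value (k · G)          ≡⟨ cong (ℤ._+_ (value G)) (value-· k G) ⟩
  value G ℤ.+ + k ℤ.* value G        ≡⟨ ℤₚ.suc-* (+ k) (value G) ⟨
  + suc k ℤ.* value G                ∎
  where open ≡-Reasoning

value-S₁S₂ : ∀ a b → value (a · S 1 ⊕ b · S 2) ≡ + b ℤ.- + a
value-S₁S₂ a b = begin
  value (a · S 1 ++ b · S 2)                 ≡⟨ value-++ (a · S 1) (b · S 2) ⟩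
  value (a · S 1) ℤ.+ value (b · S 2)        ≡⟨ cong₂ ℤ._+_ (value-· a (S 1)) (value-· b (S 2)) ⟩
  + a ℤ.* -[1+ 0 ] ℤ.+ + b ℤ.* + 1          ≡⟨ regroup (+ a) (+ b) ⟩
  + b ℤ.- + a                                ∎
  where
  open ≡-Reasoning
  regroup : ∀ x y → x ℤ.* -[1+ 0 ] ℤ.+ y ℤ.* + 1 ≡ y ℤ.- x
  regroup = solve-∀

stripValue-3*+ : ∀ k r → stripValue (3 * k + r) ≡ stripValue r
stripValue-3*+ zero    r = refl
stripValue-3*+ (suc k) r = begin
  stripValue (3 * suc k + r)       ≡⟨ cong (λ t → stripValue (t + r)) (ℕₚ.*-suc 3 k) ⟩
  stripValue (3 + 3 * k + r)       ≡⟨ cong stripValue (ℕₚ.+-assoc 3 (3 * k) r) ⟩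
  stripValue (3 * k + r)           ≡⟨ stripValue-3*+ k r ⟩
  stripValue r                     ∎
  where open ≡-Reasoning

S-≡𝒦 : ∀ n a b → stripValue n ≡ + b ℤ.- + a → S n ≡𝒦 a · S 1 ⊕ b · S 2
S-≡𝒦 n a b val = ≡𝒦-byValue (S n) (a · S 1 ⊕ b · S 2) (begin
  stripValue n ℤ.+ + 0          ≡⟨ ℤₚ.+-identityʳ (stripValue n) ⟩
  stripValue n                  ≡⟨ val ⟩
  + b ℤ.- + a                   ≡⟨ value-S₁S₂ a b ⟨
  value (a · S 1 ⊕ b · S 2)     ∎)
  where open ≡-Reasoning

theorem3p2 : ∀ (n k : ℕ) → 3 ≤ n →
    (n ≡ 3 * k → S n ≡𝒦 k · S 1 ⊕ k · S 2) ×
    (n ≡ 3 * k + 1 → S n ≡𝒦 (k + 1) · S 1 ⊕ k · S 2) ×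
    (n ≡ 3 * k + 2 → S n ≡𝒦 k · S 1 ⊕ (k + 1) · S 2)
theorem3p2 n k _ = case₀ , case₁ , case₂
  where
  case₀ : n ≡ 3 * k → S n ≡𝒦 k · S 1 ⊕ k · S 2
  case₀ refl = S-≡𝒦 (3 * k) k k (begin
    stripValue (3 * k)       ≡⟨ cong stripValue (ℕₚ.+-identityʳ (3 * k)) ⟨
    stripValue (3 * k + 0)   ≡⟨ stripValue-3*+ k 0 ⟩
    + 0                      ≡⟨ ℤₚ.+-inverseʳ (+ k) ⟨
    + k ℤ.- + k              ∎)
    where open ≡-Reasoning
  case₁ : n ≡ 3 * k + 1 → S n ≡𝒦 (k + 1) · S 1 ⊕ k · S 2
  case₁ refl = S-≡𝒦 (3 * k + 1) (k + 1) k (trans (stripValue-3*+ k 1) (down (+ k)))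
    where
    down : ∀ x → -[1+ 0 ] ≡ x ℤ.- (x ℤ.+ + 1)
    down = solve-∀
  case₂ : n ≡ 3 * k + 2 → S n ≡𝒦 k · S 1 ⊕ (k + 1) · S 2
  case₂ refl = S-≡𝒦 (3 * k + 2) k (k + 1) (trans (stripValue-3*+ k 2) (up (+ k)))
    where
    up : ∀ x → + 1 ≡ x ℤ.+ + 1 ℤ.- x
    up = solve-∀
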